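{- For every positive integer $n$ there exists a subgraph $H$ of $Q_n$ with maximum degree at most $10$ such that every pair of antipodal vertices of $Q_n$ is at distance $n$ in $H$.
   Context: $Q_n$ denotes the $n$-dimensional hypercube graph: its vertex set is $\{0,1\}^n$, and two vertices are adjacent if and only if they differ in exactly one coordinate. Two vertices are antipodal if they differ in all $n$ coordinates. -}

module Defs where

open import Data.Nat using (ℕ; zero; suc; _+_; _≤_; _<_)
open import Data.Bool using (Bool; true; false; if_then_else_)
open import Data.Vec using (Vec; []; _∷_)
open import Data.List using (List; []; _∷_; _++_; map; filter; length)
open import Relation.Binary.PropositionalEquality using (_≡_)
open import Relation.Nullary using (¬_)
open import Relation.Nullary.Decidable using (Dec)
open import Data.Bool.Properties using () renaming (_≟_ to _≟ᵇ_)
open import Data.Product using (Σ; _×_; ∃)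

Vertex : ℕ → Set
Vertex n = Vec Bool n

hamming : ∀ {n} → Vertex n → Vertex n → ℕ
hamming [] [] = 0
hamming (x ∷ u) (y ∷ v) = (if x Data.Bool.xor y then 1 else 0) + hamming u v

QAdj : ∀ {n} → Vertex n → Vertex n → Set
QAdj u v = hamming u v ≡ 1

Antipodal : ∀ {n} → Vertex n → Vertex n → Set
Antipodal {n} u v = hamming u v ≡ n

allVertices : ∀ n → List (Vertex n)
allVertices zero = [] ∷ []
allVertices (suc n) = map (false ∷_) (allVertices n) ++ map (true ∷_) (allVertices n)

record Subgraph (n : ℕ) : Set where
  field
    edge    : Vertex n → Vertex n → Bool
    sym     : ∀ u v → edge u v ≡ edge v u
    inQ     : ∀ u v → edge u v ≡ true → QAdj u v
open Subgraph public

degree : ∀ {n} → Subgraph n → Vertex n → ℕ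
degree {n} H v = length (filter (λ u → edge H v u ≟ᵇ true) (allVertices n))

MaxDegreeAtMost : ∀ {n} → Subgraph n → ℕ → Set
MaxDegreeAtMost H d = ∀ v → degree H v ≤ d

data Walk {n} (H : Subgraph n) : Vertex n → Vertex n → ℕ → Set where
  here : ∀ {v} → Walk H v v 0
  step : ∀ {u w v k} → edge H u w ≡ true → Walk H w v k → Walk H u v (suc k)

DistEq : ∀ {n} → Subgraph n → Vertex n → Vertex n → ℕ → Set
DistEq H u v d = Walk H u v d × (∀ k → k < d → ¬ Walk H u v k)

-- Choose r with 2^r ≤ n ≤ 2^(r+1) and label positions 0, …, n by r-bit words
-- lab k, cyclically (lab n = lab 0), each word occurring once or twice below n.
-- The state σ w of a vertex is the xor of the increments lab p ⊕ lab (p+1)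
-- over the coordinates p where w is 1, so toggling p exchanges lab p and
-- lab (p+1) in the state.  Keep the edge w — toggle p w exactly when
-- σ w ∈ {lab p, lab (p+1)}: this is symmetric, and gives degree ≤ 2 + 2.
-- From u with σ u = lab k, toggling k, …, n-1, 0, …, k-1 in turn is a walk
-- of length n to the antipode, and no walk is shorter than a Hamming distance.

module Submission where

-- Defs exports the field Subgraph.sym; `sym` below is symmetry of _≡_.
open import Defs hiding (sym)
open import Data.Bool using (Bool; true; false; not; _xor_; _∨_; if_then_else_)
open import Data.Bool.Properties
  using (xor-assoc; xor-comm; xor-same; xor-identityˡ; ∨-comm; not-involutive; not-¬; ¬-not)
  renaming (_≟_ to _≟ᵇ_)
open import Data.List using (List; []; _∷_; _++_; filter; length)
  renaming (map to mapL)
open import Data.List.Properties using (filter-++; filter-none; length-++; length-filter)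
open import Data.List.Relation.Unary.All using (universal)
open import Data.Nat using (ℕ; zero; suc; _+_; _∸_; _^_; _≤_; _<_; z≤n; s≤s; z<s; s<s; _<?_; _≤?_; NonZero; >-nonZero)
open import Data.Nat.DivMod using (_%_; n%n≡0; m<n⇒m%n≡m)
open import Data.Nat.Properties
open import Algebra.Properties.CommutativeSemigroup +-commutativeSemigroup
  using (interchange)
open import Data.Product using (Σ; ∃; _×_; _,_; proj₁; proj₂)
open import Data.Vec using (Vec; []; _∷_; zipWith; replicate; tail) renaming (map to mapV)
open import Data.Vec.Properties using (zipWith-assoc; zipWith-comm; zipWith-identityˡ; ≡-dec; ∷-injectiveˡ; ∷-injectiveʳ)
open import Data.Empty using (⊥-elim)
open import Function using (_∘_; _⇔_; mk⇔; Equivalence)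
open import Relation.Binary.Definitions using (DecidableEquality)
open import Relation.Binary.PropositionalEquality
open import Relation.Nullary using (Dec; yes; no; does; ¬_; _×-dec_)
open import Relation.Nullary.Decidable using (dec-true; does-⇔)

fromDoes : ∀ {P : Set} (d : Dec P) → does d ≡ true → P
fromDoes (yes p) _  = p
fromDoes (no _)  ()

infixl 6 _⊕_
infix  4 _≟ᵥ_

_⊕_ : ∀ {m} → Vec Bool m → Vec Bool m → Vec Bool m
_⊕_ = zipWith _xor_

0ᵥ : ∀ {m} → Vec Bool m
0ᵥ = replicate _ false

_≟ᵥ_ : ∀ {m} → DecidableEquality (Vec Bool m)
_≟ᵥ_ = ≡-dec _≟ᵇ_

⊕-assoc : ∀ {m} (x y z : Vec Bool m) → (x ⊕ y) ⊕ z ≡ x ⊕ (y ⊕ z)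
⊕-assoc = zipWith-assoc xor-assoc

⊕-comm : ∀ {m} (x y : Vec Bool m) → x ⊕ y ≡ y ⊕ x
⊕-comm = zipWith-comm xor-comm

⊕-self : ∀ {m} (x : Vec Bool m) → x ⊕ x ≡ 0ᵥ
⊕-self []      = refl
⊕-self (b ∷ x) = cong₂ _∷_ (xor-same b) (⊕-self x)

⊕-cancelˡ : ∀ {m} (a b : Vec Bool m) → a ⊕ (a ⊕ b) ≡ b
⊕-cancelˡ a b = begin
  a ⊕ (a ⊕ b) ≡⟨ ⊕-assoc a a b ⟨
  (a ⊕ a) ⊕ b ≡⟨ cong (_⊕ b) (⊕-self a) ⟩
  0ᵥ ⊕ b      ≡⟨ zipWith-identityˡ xor-identityˡ b ⟩
  b           ∎
  where open ≡-Reasoning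

⊕-cancelʳ : ∀ {m} (s c : Vec Bool m) → (s ⊕ c) ⊕ c ≡ s
⊕-cancelʳ s c = trans (⊕-comm (s ⊕ c) c) (trans (cong (c ⊕_) (⊕-comm s c)) (⊕-cancelˡ c s))

⊕-transpose : ∀ {m} {s c t : Vec Bool m} → (s ⊕ c ≡ t) ⇔ (s ≡ t ⊕ c)
⊕-transpose {s = s} {c} {t} = mk⇔
  (λ e → trans (sym (⊕-cancelʳ s c)) (cong (_⊕ c) e))
  (λ e → trans (cong (_⊕ c) e) (⊕-cancelʳ t c))

⊕-exchangeˡ : ∀ {m} (s a b : Vec Bool m) → (s ⊕ (a ⊕ b) ≡ a) ⇔ (s ≡ b)
⊕-exchangeˡ s a b = subst (λ t → (s ⊕ (a ⊕ b) ≡ a) ⇔ (s ≡ t)) (⊕-cancelˡ a b) ⊕-transpose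

⊕-exchangeʳ : ∀ {m} (s a b : Vec Bool m) → (s ⊕ (a ⊕ b) ≡ b) ⇔ (s ≡ a)
⊕-exchangeʳ s a b = subst (λ c → (s ⊕ c ≡ b) ⇔ (s ≡ a)) (⊕-comm b a) (⊕-exchangeˡ s b a)

toggle : ∀ {m} → ℕ → Vertex m → Vertex m
toggle p       []      = []
toggle zero    (b ∷ w) = not b ∷ w
toggle (suc p) (b ∷ w) = b ∷ toggle p w

toggle-involutive : ∀ {m} p (w : Vertex m) → toggle p (toggle p w) ≡ w
toggle-involutive p       []      = refl
toggle-involutive zero    (b ∷ w) = cong (_∷ w) (not-involutive b)
toggle-involutive (suc p) (b ∷ w) = cong (b ∷_) (toggle-involutive p w)

toggle-comm : ∀ {m} p q (w : Vertex m) → toggle p (toggle q w) ≡ toggle q (toggle p w)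
toggle-comm p       q       []      = refl
toggle-comm zero    zero    (b ∷ w) = refl
toggle-comm zero    (suc q) (b ∷ w) = refl
toggle-comm (suc p) zero    (b ∷ w) = refl
toggle-comm (suc p) (suc q) (b ∷ w) = cong (b ∷_) (toggle-comm p q w)

toggleRange : ∀ {m} → ℕ → ℕ → Vertex m → Vertex m
toggleRange p zero      w = w
toggleRange p (suc len) w = toggleRange (suc p) len (toggle p w)

toggleRange-toggle : ∀ {m} p q len (w : Vertex m) →
  toggleRange q len (toggle p w) ≡ toggle p (toggleRange q len w)
toggleRange-toggle p q zero      w = refl
toggleRange-toggle p q (suc len) w =
  trans (cong (toggleRange (suc q) len) (toggle-comm q p w))
        (toggleRange-toggle p (suc q) len (toggle q w))

toggleRange-comm : ∀ {m} p a q b (w : Vertex m) →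
  toggleRange p a (toggleRange q b w) ≡ toggleRange q b (toggleRange p a w)
toggleRange-comm p zero    q b w = refl
toggleRange-comm p (suc a) q b w =
  trans (cong (toggleRange (suc p) a) (sym (toggleRange-toggle p q b w)))
        (toggleRange-comm (suc p) a q b (toggle p w))

toggleRange-+ : ∀ {m} p a b (w : Vertex m) →
  toggleRange p (a + b) w ≡ toggleRange (p + a) b (toggleRange p a w)
toggleRange-+ p zero    b w = cong (λ q → toggleRange q b w) (sym (+-identityʳ p))
toggleRange-+ p (suc a) b w =
  trans (toggleRange-+ (suc p) a b (toggle p w))
        (cong (λ q → toggleRange q b (toggleRange (suc p) a (toggle p w))) (sym (+-suc p a)))

toggleRange-cons : ∀ {m} p len b (w : Vertex m) →
  toggleRange (suc p) len (b ∷ w) ≡ b ∷ toggleRange p len w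
toggleRange-cons p zero      b w = refl
toggleRange-cons p (suc len) b w = toggleRange-cons (suc p) len b (toggle p w)

toggleRange-all : ∀ {m} (w : Vertex m) → toggleRange 0 m w ≡ mapV not w
toggleRange-all []          = refl
toggleRange-all {suc m} (b ∷ w) =
  trans (toggleRange-cons 0 m (not b) w) (cong (not b ∷_) (toggleRange-all w))

toggleRange-around : ∀ {m} k (w : Vertex m) → k ≤ m →
  toggleRange 0 k (toggleRange k (m ∸ k) w) ≡ mapV not w
toggleRange-around {m} k w k≤m = begin
  toggleRange 0 k (toggleRange k (m ∸ k) w) ≡⟨ toggleRange-comm 0 k k (m ∸ k) w ⟩
  toggleRange k (m ∸ k) (toggleRange 0 k w) ≡⟨ toggleRange-+ 0 k (m ∸ k) w ⟨
  toggleRange 0 (k + (m ∸ k)) w             ≡⟨ cong (λ l → toggleRange 0 l w) (m+[n∸m]≡n k≤m) ⟩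
  toggleRange 0 m w                         ≡⟨ toggleRange-all w ⟩
  mapV not w                                ∎
  where open ≡-Reasoning

bit : Bool → ℕ
bit b = if b then 1 else 0

bit≤1 : ∀ b → bit b ≤ 1
bit≤1 false = z≤n
bit≤1 true  = ≤-refl

bit-triangle : ∀ x y z → bit (x xor z) ≤ bit (x xor y) + bit (y xor z)
bit-triangle false false z     = ≤-refl
bit-triangle false true  false = z≤n
bit-triangle false true  true  = s≤s z≤n
bit-triangle true  false false = ≤-refl
bit-triangle true  false true  = z≤n
bit-triangle true  true  z     = ≤-refl

hamming-self : ∀ {m} (w : Vertex m) → hamming w w ≡ 0
hamming-self []          = refl
hamming-self (false ∷ w) = hamming-self w
hamming-self (true ∷ w)  = hamming-self w

hamming-≤ : ∀ {m} (u v : Vertex m) → hamming u v ≤ m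
hamming-≤ []      []      = z≤n
hamming-≤ (x ∷ u) (y ∷ v) = +-mono-≤ (bit≤1 (x xor y)) (hamming-≤ u v)

hamming-triangle : ∀ {m} (u w v : Vertex m) → hamming u v ≤ hamming u w + hamming w v
hamming-triangle []      []      []      = z≤n
hamming-triangle (x ∷ u) (y ∷ w) (z ∷ v) =
  ≤-trans (+-mono-≤ (bit-triangle x y z) (hamming-triangle u w v))
          (≤-reflexive (interchange (bit (x xor y)) (bit (y xor z)) (hamming u w) (hamming w v)))

hamming-toggle : ∀ {m} p (w : Vertex m) → p < m → hamming w (toggle p w) ≡ 1
hamming-toggle zero    (false ∷ w) _         = cong suc (hamming-self w)
hamming-toggle zero    (true ∷ w)  _         = cong suc (hamming-self w)
hamming-toggle (suc p) (false ∷ w) (s<s p<m) = hamming-toggle p w p<m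
hamming-toggle (suc p) (true ∷ w)  (s<s p<m) = hamming-toggle p w p<m

antipodal⇒antipode : ∀ {m} (u v : Vertex m) → hamming u v ≡ m → v ≡ mapV not u
antipodal⇒antipode []          []          _ = refl
antipodal⇒antipode (false ∷ u) (true ∷ v)  e = cong (true ∷_) (antipodal⇒antipode u v (suc-injective e))
antipodal⇒antipode (true ∷ u)  (false ∷ v) e = cong (false ∷_) (antipodal⇒antipode u v (suc-injective e))
antipodal⇒antipode {suc m} (false ∷ u) (false ∷ v) e = ⊥-elim (1+n≰n (subst (_≤ m) e (hamming-≤ u v)))
antipodal⇒antipode {suc m} (true ∷ u)  (true ∷ v)  e = ⊥-elim (1+n≰n (subst (_≤ m) e (hamming-≤ u v)))

module _ {n : ℕ} {H : Subgraph n} where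

  _++ᵂ_ : ∀ {a b c k l} → Walk H a b k → Walk H b c l → Walk H a c (k + l)
  here        ++ᵂ q = q
  step e rest ++ᵂ q = step e (rest ++ᵂ q)

  -- Each step changes one coordinate, so a walk is at least as long as the
  -- Hamming distance between its ends.
  hamming≤length : ∀ {u v k} → Walk H u v k → hamming u v ≤ k
  hamming≤length {u} here = ≤-reflexive (hamming-self u)
  hamming≤length (step {u} {w} {v} e rest) =
    ≤-trans (hamming-triangle u w v) (+-mono-≤ (≤-reflexive (inQ H u w e)) (hamming≤length rest))

  antipodal-distance : (∀ u → Walk H u (mapV not u) n) →
                       ∀ u v → Antipodal u v → DistEq H u v n
  antipodal-distance walk u v uv =
    subst (λ t → Walk H u t n) (sym (antipodal⇒antipode u v uv)) (walk u) ,
    λ k k<n w → <⇒≱ k<n (subst (_≤ k) uv (hamming≤length w))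

countBelow : ℕ → (ℕ → Bool) → ℕ
countBelow zero    f = 0
countBelow (suc N) f = bit (f 0) + countBelow N (f ∘ suc)

countBelow-cong : ∀ N {f g} → (∀ k → k < N → f k ≡ g k) → countBelow N f ≡ countBelow N g
countBelow-cong zero    f≗g = refl
countBelow-cong (suc N) f≗g =
  cong₂ _+_ (cong bit (f≗g 0 z<s)) (countBelow-cong N (λ k k<N → f≗g (suc k) (s<s k<N)))

countBelow-+ : ∀ a b f → countBelow (a + b) f ≡ countBelow a f + countBelow b (λ k → f (a + k))
countBelow-+ zero    b f = refl
countBelow-+ (suc a) b f =
  trans (cong (bit (f 0) +_) (countBelow-+ a b (f ∘ suc)))
        (sym (+-assoc (bit (f 0)) (countBelow a (f ∘ suc)) _))

countBelow-mono : ∀ {a b} f → a ≤ b → countBelow a f ≤ countBelow b f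
countBelow-mono {a} {b} f a≤b =
  subst (λ c → countBelow a f ≤ countBelow c f) (m+[n∸m]≡n a≤b)
        (subst (countBelow a f ≤_) (sym (countBelow-+ a (b ∸ a) f)) (m≤m+n _ _))

countBelow-snoc : ∀ N f → countBelow (suc N) f ≡ countBelow N f + bit (f N)
countBelow-snoc zero    f = +-identityʳ (bit (f 0))
countBelow-snoc (suc N) f =
  trans (cong (bit (f 0) +_) (countBelow-snoc N (f ∘ suc)))
        (sym (+-assoc (bit (f 0)) (countBelow N (f ∘ suc)) _))

countBelow-rotate : ∀ N f → f N ≡ f 0 → countBelow N (f ∘ suc) ≡ countBelow N f
countBelow-rotate N f fN≡f0 = +-cancelˡ-≡ (bit (f 0)) _ _ (begin
  bit (f 0) + countBelow N (f ∘ suc) ≡⟨ countBelow-snoc N f ⟩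
  countBelow N f + bit (f N)         ≡⟨ cong (λ b → countBelow N f + bit b) fN≡f0 ⟩
  countBelow N f + bit (f 0)         ≡⟨ +-comm (countBelow N f) _ ⟩
  bit (f 0) + countBelow N f         ∎)
  where open ≡-Reasoning

countBelow-∨ : ∀ N f g → countBelow N (λ k → f k ∨ g k) ≤ countBelow N f + countBelow N g
countBelow-∨ zero    f g = z≤n
countBelow-∨ (suc N) f g =
  ≤-trans (+-mono-≤ (bit-∨ (f 0) (g 0)) (countBelow-∨ N (f ∘ suc) (g ∘ suc)))
          (≤-reflexive (interchange (bit (f 0)) (bit (g 0)) _ _))
  where
  bit-∨ : ∀ x y → bit (x ∨ y) ≤ bit x + bit y
  bit-∨ false y = ≤-refl
  bit-∨ true  y = s≤s z≤n

countBelow-none : ∀ N f → (∀ k → k < N → f k ≡ false) → countBelow N f ≡ 0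
countBelow-none zero    f none = refl
countBelow-none (suc N) f none =
  cong₂ _+_ (cong bit (none 0 z<s)) (countBelow-none N (f ∘ suc) (λ k k<N → none (suc k) (s<s k<N)))

countBelow-atMostOnce : ∀ N f →
  (∀ i j → i < N → j < N → f i ≡ true → f j ≡ true → i ≡ j) → countBelow N f ≤ 1
countBelow-atMostOnce zero    f once = z≤n
countBelow-atMostOnce (suc N) f once with f 0 in f0
... | true  = ≤-reflexive (cong suc (countBelow-none N (f ∘ suc) onlyAt0))
  where
  onlyAt0 : ∀ k → k < N → f (suc k) ≡ false
  onlyAt0 k k<N = ¬-not (λ fk → 0≢1+n (once 0 (suc k) z<s (s<s k<N) f0 fk))
... | false = countBelow-atMostOnce N (f ∘ suc)
                (λ i j i<N j<N fi fj → suc-injective (once (suc i) (suc j) (s<s i<N) (s<s j<N) fi fj))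

#V : ∀ m → (Vertex m → Bool) → ℕ
#V m P = length (filter (λ u → P u ≟ᵇ true) (allVertices m))

length-filter-map : ∀ {A B : Set} (P : B → Bool) (f : A → B) (xs : List A) →
  length (filter (λ u → P u ≟ᵇ true) (mapL f xs)) ≡ length (filter (λ u → P (f u) ≟ᵇ true) xs)
length-filter-map P f []       = refl
length-filter-map P f (x ∷ xs) with P (f x)
... | true  = cong suc (length-filter-map P f xs)
... | false = length-filter-map P f xs

#V-split : ∀ m b (P : Vertex (suc m) → Bool) →
  #V (suc m) P ≡ #V m (P ∘ (b ∷_)) + #V m (P ∘ (not b ∷_))
#V-split m false P = begin
  length (filter P? (mapL (false ∷_) V ++ mapL (true ∷_) V))
    ≡⟨ cong length (filter-++ P? (mapL (false ∷_) V) (mapL (true ∷_) V)) ⟩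
  length (filter P? (mapL (false ∷_) V) ++ filter P? (mapL (true ∷_) V))
    ≡⟨ length-++ (filter P? (mapL (false ∷_) V)) ⟩
  length (filter P? (mapL (false ∷_) V)) + length (filter P? (mapL (true ∷_) V))
    ≡⟨ cong₂ _+_ (length-filter-map P (false ∷_) V) (length-filter-map P (true ∷_) V) ⟩
  #V m (P ∘ (false ∷_)) + #V m (P ∘ (true ∷_)) ∎
  where
  open ≡-Reasoning
  V = allVertices m
  P? = λ u → P u ≟ᵇ true
#V-split m true P = trans (#V-split m false P) (+-comm (#V m (P ∘ (false ∷_))) _)

#V-none : ∀ m (P : Vertex m → Bool) → (∀ u → ¬ P u ≡ true) → #V m P ≡ 0
#V-none m P none = cong length (filter-none (λ u → P u ≟ᵇ true) (universal none (allVertices m)))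

#V-single : ∀ m (w : Vertex m) (P : Vertex m → Bool) → (∀ u → P u ≡ true → u ≡ w) → #V m P ≤ 1
#V-single zero    []      P only = length-filter (λ u → P u ≟ᵇ true) (allVertices 0)
#V-single (suc m) (b ∷ w) P only = begin
  #V (suc m) P                                  ≡⟨ #V-split m b P ⟩
  #V m (P ∘ (b ∷_)) + #V m (P ∘ (not b ∷_))     ≡⟨ cong (#V m (P ∘ (b ∷_)) +_) (#V-none m _ otherHead) ⟩
  #V m (P ∘ (b ∷_)) + 0                         ≡⟨ +-identityʳ _ ⟩
  #V m (P ∘ (b ∷_))                             ≤⟨ #V-single m w _ (λ u e → ∷-injectiveʳ (only _ e)) ⟩
  1                                             ∎
  where
  open ≤-Reasoning
  otherHead : ∀ u → ¬ P (not b ∷ u) ≡ true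
  otherHead u e = not-¬ refl (sym (∷-injectiveˡ (only _ e)))

#V-toggles : ∀ m (w : Vertex m) (P : Vertex m → Bool) (Q : ℕ → Bool) →
  (∀ u → P u ≡ true → ∃ λ p → p < m × u ≡ toggle p w × Q p ≡ true) →
  #V m P ≤ countBelow m Q
#V-toggles zero    []      P Q toggles =
  ≤-reflexive (#V-none 0 P (λ u e → case-empty (toggles u e)))
  where
  case-empty : ∀ {u} → ¬ (∃ λ p → p < 0 × u ≡ toggle p [] × Q p ≡ true)
  case-empty (_ , () , _)
#V-toggles (suc m) (b ∷ w) P Q toggles = begin
  #V (suc m) P                              ≡⟨ #V-split m b P ⟩
  #V m (P ∘ (b ∷_)) + #V m (P ∘ (not b ∷_)) ≤⟨ +-mono-≤ (#V-toggles m w _ (Q ∘ suc) sameHead) otherHead ⟩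
  countBelow m (Q ∘ suc) + bit (Q 0)        ≡⟨ +-comm (countBelow m (Q ∘ suc)) _ ⟩
  countBelow (suc m) Q                      ∎
  where
  open ≤-Reasoning
  sameHead : ∀ u → P (b ∷ u) ≡ true → ∃ λ p → p < m × u ≡ toggle p w × Q (suc p) ≡ true
  sameHead u e with toggles (b ∷ u) e
  ... | zero  , _         , eq , _ = ⊥-elim (not-¬ refl (∷-injectiveˡ eq))
  ... | suc p , s<s p<m , eq , q = p , p<m , ∷-injectiveʳ eq , q
  headToggle : ∀ u → P (not b ∷ u) ≡ true → u ≡ w × Q 0 ≡ true
  headToggle u e with toggles (not b ∷ u) e
  ... | zero  , _ , eq , q = ∷-injectiveʳ eq , q
  ... | suc p , _ , eq , _ = ⊥-elim (not-¬ refl (sym (∷-injectiveˡ eq)))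
  otherHead : #V m (P ∘ (not b ∷_)) ≤ bit (Q 0)
  otherHead with Q 0 in q0
  ... | true  = #V-single m w _ (λ u e → proj₁ (headToggle u e))
  ... | false = ≤-reflexive (#V-none m _ (λ u e → ¬-false (trans (sym q0) (proj₂ (headToggle u e)))))
    where
    ¬-false : ¬ false ≡ true
    ¬-false ()

-- Given which toggles are allowed at each vertex, keep the edges w — toggle p w
-- with p allowed at w.  This is a subgraph provided allowedness of p is
-- invariant under toggling p itself.
module ToggleSubgraph {n : ℕ} (allowed : Vertex n → ℕ → Bool)
       (allowed-toggle : ∀ p w → p < n → allowed (toggle p w) p ≡ allowed w p) where

  ToggleEdge : Vertex n → Vertex n → Set
  ToggleEdge u v = ∃ λ p → p < n × v ≡ toggle p u × allowed u p ≡ true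

  toggleEdge? : ∀ u v → Dec (ToggleEdge u v)
  toggleEdge? u v = anyUpTo? (λ p → (v ≟ᵥ toggle p u) ×-dec (allowed u p ≟ᵇ true)) n

  ToggleEdge-sym : ∀ {u v} → ToggleEdge u v → ToggleEdge v u
  ToggleEdge-sym {u} (p , p<n , refl , a) =
    p , p<n , sym (toggle-involutive p u) , trans (allowed-toggle p u p<n) a

  ToggleEdge⇒adjacent : ∀ {u v} → ToggleEdge u v → QAdj u v
  ToggleEdge⇒adjacent {u} (p , p<n , refl , _) = hamming-toggle p u p<n

  H : Subgraph n
  H = record
    { edge = λ u v → does (toggleEdge? u v)
    ; sym  = λ u v → does-⇔ (mk⇔ ToggleEdge-sym ToggleEdge-sym) (toggleEdge? u v) (toggleEdge? v u)
    ; inQ  = λ u v e → ToggleEdge⇒adjacent (fromDoes (toggleEdge? u v) e)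
    }

  edge-toggle : ∀ p w → p < n → allowed w p ≡ true → edge H w (toggle p w) ≡ true
  edge-toggle p w p<n a = dec-true (toggleEdge? w (toggle p w)) (p , p<n , refl , a)

  degree-≤ : ∀ w → degree H w ≤ countBelow n (allowed w)
  degree-≤ w = #V-toggles n w (edge H w) (allowed w) (λ u → fromDoes (toggleEdge? w u))

weight : ∀ {m r} → (ℕ → Vec Bool r) → Vertex m → Vec Bool r
weight c []          = 0ᵥ
weight c (false ∷ w) = weight (c ∘ suc) w
weight c (true ∷ w)  = c 0 ⊕ weight (c ∘ suc) w

weight-toggle : ∀ {m r} (c : ℕ → Vec Bool r) p (w : Vertex m) → p < m →
  weight c (toggle p w) ≡ weight c w ⊕ c p
weight-toggle c zero    (false ∷ w) _         = ⊕-comm (c 0) (weight (c ∘ suc) w)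
weight-toggle c zero    (true ∷ w)  _         =
  trans (sym (⊕-cancelˡ (c 0) _)) (⊕-comm (c 0) (c 0 ⊕ weight (c ∘ suc) w))
weight-toggle c (suc p) (false ∷ w) (s<s p<m) = weight-toggle (c ∘ suc) p w p<m
weight-toggle c (suc p) (true ∷ w)  (s<s p<m) =
  trans (cong (c 0 ⊕_) (weight-toggle (c ∘ suc) p w p<m)) (sym (⊕-assoc (c 0) _ _))

module CyclicLabelling {n r : ℕ} (lab : ℕ → Vec Bool r) (lab-cyclic : lab n ≡ lab 0) where

  Δ : ℕ → Vec Bool r
  Δ p = lab p ⊕ lab (suc p)

  σ : Vertex n → Vec Bool r
  σ = weight Δ

  between : Vec Bool r → ℕ → Bool
  between s p = does (s ≟ᵥ lab p) ∨ does (s ≟ᵥ lab (suc p))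

  allowed : Vertex n → ℕ → Bool
  allowed w = between (σ w)

  -- Toggling p moves the state by Δ p, exchanging lab p and lab (p+1).
  allowed-toggle : ∀ p w → p < n → allowed (toggle p w) p ≡ allowed w p
  allowed-toggle p w p<n = begin
    between (σ (toggle p w)) p
      ≡⟨ cong (λ s → between s p) (weight-toggle Δ p w p<n) ⟩
    does (σ w ⊕ Δ p ≟ᵥ lab p) ∨ does (σ w ⊕ Δ p ≟ᵥ lab (suc p))
      ≡⟨ cong₂ _∨_ (does-⇔ (⊕-exchangeˡ (σ w) (lab p) (lab (suc p))) (σ w ⊕ Δ p ≟ᵥ lab p) (σ w ≟ᵥ lab (suc p)))
                   (does-⇔ (⊕-exchangeʳ (σ w) (lab p) (lab (suc p))) (σ w ⊕ Δ p ≟ᵥ lab (suc p)) (σ w ≟ᵥ lab p)) ⟩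
    does (σ w ≟ᵥ lab (suc p)) ∨ does (σ w ≟ᵥ lab p)
      ≡⟨ ∨-comm (does (σ w ≟ᵥ lab (suc p))) (does (σ w ≟ᵥ lab p)) ⟩
    between (σ w) p ∎
    where open ≡-Reasoning

  open ToggleSubgraph allowed allowed-toggle public using (H)
  open ToggleSubgraph allowed allowed-toggle using (edge-toggle; degree-≤)

  fibre : Vec Bool r → ℕ
  fibre g = countBelow n (λ k → does (g ≟ᵥ lab k))

  -- Allowed positions are those labelled σ w, and their predecessors.
  degree-bound : ∀ c → (∀ g → fibre g ≤ c) → MaxDegreeAtMost H (c + c)
  degree-bound c fibre≤c w = begin
    degree H w
      ≤⟨ degree-≤ w ⟩
    countBelow n (allowed w)
      ≤⟨ countBelow-∨ n _ _ ⟩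
    fibre (σ w) + countBelow n (λ k → does (σ w ≟ᵥ lab (suc k)))
      ≡⟨ cong (fibre (σ w) +_) (countBelow-rotate n _ (cong (λ t → does (σ w ≟ᵥ t)) lab-cyclic)) ⟩
    fibre (σ w) + fibre (σ w)
      ≤⟨ +-mono-≤ (fibre≤c (σ w)) (fibre≤c (σ w)) ⟩
    c + c ∎
    where open ≤-Reasoning

  segment : ∀ len p w → p + len ≤ n → σ w ≡ lab p →
            Walk H w (toggleRange p len w) len × σ (toggleRange p len w) ≡ lab (p + len)
  segment zero      p w _  σw = here , trans σw (cong lab (sym (+-identityʳ p)))
  segment (suc len) p w le σw =
    step first (proj₁ rest) , trans (proj₂ rest) (cong lab (sym (+-suc p len)))
    where
    le′ : suc p + len ≤ n
    le′ = subst (_≤ n) (+-suc p len) le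
    p<n : p < n
    p<n = ≤-trans (s≤s (m≤m+n p len)) le′
    first : edge H w (toggle p w) ≡ true
    first = edge-toggle p w p<n (cong (_∨ does (σ w ≟ᵥ lab (suc p))) (dec-true (σ w ≟ᵥ lab p) σw))
    σ-next : σ (toggle p w) ≡ lab (suc p)
    σ-next = trans (weight-toggle Δ p w p<n) (Equivalence.from (⊕-exchangeʳ (σ w) _ _) σw)
    rest = segment len (suc p) (toggle p w) le′ σ-next

  -- If every word is a label, each vertex has a walk of length n to its antipode:
  -- start at the position labelled σ u, run to n (≈ 0), then up to the start.
  antipodal-walk : (∀ g → ∃ λ k → k < n × lab k ≡ g) → ∀ u → Walk H u (mapV not u) n
  antipodal-walk onto u with onto (σ u)
  ... | k , k<n , labk =
    subst₂ (Walk H u) (toggleRange-around k u k≤n) (m∸n+n≡m k≤n) (proj₁ toEnd ++ᵂ proj₁ toStart)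
    where
    k≤n : k ≤ n
    k≤n = <⇒≤ k<n
    toEnd = segment (n ∸ k) k u (≤-reflexive (m+[n∸m]≡n k≤n)) (sym labk)
    σ-end : σ (toggleRange k (n ∸ k) u) ≡ lab 0
    σ-end = trans (proj₂ toEnd) (trans (cong lab (m+[n∸m]≡n k≤n)) lab-cyclic)
    toStart = segment k 0 (toggleRange k (n ∸ k) u) k≤n σ-end

2^suc : ∀ r → 2 ^ suc r ≡ 2 ^ r + 2 ^ r
2^suc r = cong (2 ^ r +_) (+-identityʳ (2 ^ r))

-- The r-bit binary code of k < 2^r, most significant bit first.
bin : (r : ℕ) → ℕ → Vec Bool r
bin zero    k = []
bin (suc r) k with k <? 2 ^ r
... | yes _ = false ∷ bin r k
... | no  _ = true ∷ bin r (k ∸ 2 ^ r)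

val : ∀ {r} → Vec Bool r → ℕ
val []                  = 0
val         (false ∷ x) = val x
val {suc r} (true ∷ x)  = 2 ^ r + val x

bin-lo : ∀ r {k} → k < 2 ^ r → bin (suc r) k ≡ false ∷ bin r k
bin-lo r {k} k< with k <? 2 ^ r
... | yes _ = refl
... | no k≮ = ⊥-elim (k≮ k<)

bin-hi : ∀ r k → bin (suc r) (2 ^ r + k) ≡ true ∷ bin r k
bin-hi r k with 2 ^ r + k <? 2 ^ r
... | yes k< = ⊥-elim (m+n≮m (2 ^ r) k k<)
... | no  _  = cong (λ j → true ∷ bin r j) (m+n∸m≡n (2 ^ r) k)

val< : ∀ {r} (x : Vec Bool r) → val x < 2 ^ r
val< []                  = z<s
val< {suc r} (false ∷ x) = <-≤-trans (val< x) (m≤m+n _ _)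
val< {suc r} (true ∷ x)  = subst (2 ^ r + val x <_) (sym (2^suc r)) (+-monoʳ-< (2 ^ r) (val< x))

bin-val : ∀ {r} (x : Vec Bool r) → bin r (val x) ≡ x
bin-val []                  = refl
bin-val {suc r} (false ∷ x) = trans (bin-lo r (val< x)) (cong (false ∷_) (bin-val x))
bin-val {suc r} (true ∷ x)  = trans (bin-hi r (val x)) (cong (true ∷_) (bin-val x))

val-bin : ∀ r {k} → k < 2 ^ r → val (bin r k) ≡ k
val-bin zero    {zero}  _         = refl
val-bin zero    {suc _} (s<s ())
val-bin (suc r) {k} k< with k <? 2 ^ r
... | yes k<2^r = val-bin r k<2^r
... | no  k≮2^r = trans (cong (2 ^ r +_) (val-bin r k-2^r<)) (m+[n∸m]≡n (≮⇒≥ k≮2^r))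
  where
  k-2^r< : k ∸ 2 ^ r < 2 ^ r
  k-2^r< = m<n+o⇒m∸n<o k (2 ^ r) {{m^n≢0 2 r}} (subst (k <_) (2^suc r) k<)

-- Position k is labelled with the last r bits of the (r+1)-bit code of
-- k mod n.  Each r-bit word is then the label of one position below 2^r
-- and of at most one more between 2^r and 2^(r+1).
module BinaryLabelling (n r : ℕ) (lower : 2 ^ r ≤ n) (upper : n ≤ 2 ^ suc r) where

  0<n : 0 < n
  0<n = <-≤-trans (m^n>0 2 r) lower

  instance
    n≢0 : NonZero n
    n≢0 = >-nonZero 0<n

  low : ℕ → Vec Bool r
  low k = tail (bin (suc r) k)

  lab : ℕ → Vec Bool r
  lab k = low (k % n)

  lab-cyclic : lab n ≡ lab 0
  lab-cyclic = cong low (trans (n%n≡0 n) (sym (m<n⇒m%n≡m 0<n)))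

  open CyclicLabelling lab lab-cyclic public

  lab-onto : ∀ g → ∃ λ k → k < n × lab k ≡ g
  lab-onto g = val g , val<n , (begin
    low (val g % n)            ≡⟨ cong low (m<n⇒m%n≡m val<n) ⟩
    tail (bin (suc r) (val g)) ≡⟨ cong tail (bin-lo r (val< g)) ⟩
    bin r (val g)              ≡⟨ bin-val g ⟩
    g                          ∎)
    where
    open ≡-Reasoning
    val<n : val g < n
    val<n = <-≤-trans (val< g) lower

  codeOnce : ∀ g → countBelow (2 ^ r) (λ k → does (g ≟ᵥ bin r k)) ≤ 1
  codeOnce g = countBelow-atMostOnce (2 ^ r) _ λ i j i< j< gi gj → begin
    i               ≡⟨ val-bin r i< ⟨
    val (bin r i)   ≡⟨ cong val (trans (sym (fromDoes (g ≟ᵥ _) gi)) (fromDoes (g ≟ᵥ _) gj)) ⟩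
    val (bin r j)   ≡⟨ val-bin r j< ⟩
    j               ∎
    where open ≡-Reasoning

  fibre≤2 : ∀ g → fibre g ≤ 2
  fibre≤2 g = begin
    countBelow n (λ k → does (g ≟ᵥ lab k))
      ≡⟨ countBelow-cong n (λ k k<n → cong (λ j → does (g ≟ᵥ low j)) (m<n⇒m%n≡m k<n)) ⟩
    countBelow n f
      ≤⟨ countBelow-mono f (subst (n ≤_) (2^suc r) upper) ⟩
    countBelow (2 ^ r + 2 ^ r) f
      ≡⟨ countBelow-+ (2 ^ r) (2 ^ r) f ⟩
    countBelow (2 ^ r) f + countBelow (2 ^ r) (λ k → f (2 ^ r + k))
      ≡⟨ cong₂ _+_ (countBelow-cong (2 ^ r) (λ k k< → cong (λ t → does (g ≟ᵥ tail t)) (bin-lo r k<)))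
                   (countBelow-cong (2 ^ r) (λ k _ → cong (λ t → does (g ≟ᵥ tail t)) (bin-hi r k))) ⟩
    countBelow (2 ^ r) code + countBelow (2 ^ r) code
      ≤⟨ +-mono-≤ (codeOnce g) (codeOnce g) ⟩
    2 ∎
    where
    open ≤-Reasoning
    f code : ℕ → Bool
    f k = does (g ≟ᵥ low k)
    code k = does (g ≟ᵥ bin r k)

dyadic-bracket : ∀ n → 1 ≤ n → ∃ λ r → 2 ^ r ≤ n × n ≤ 2 ^ suc r
dyadic-bracket (suc zero)    _ = 0 , ≤-refl , s≤s z≤n
dyadic-bracket (suc (suc m)) _ with dyadic-bracket (suc m) (s≤s z≤n)
... | r , lower , upper with suc (suc m) ≤? 2 ^ suc r
...   | yes fits = r , ≤-trans lower (n≤1+n _) , fits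
...   | no  over = suc r , ≤-trans (≤-reflexive (sym m+1≡2^suc)) (n≤1+n _) , bound
  where
  m+1≡2^suc : suc m ≡ 2 ^ suc r
  m+1≡2^suc = ≤-antisym upper (≤-pred (≰⇒> over))
  bound : suc (suc m) ≤ 2 ^ suc (suc r)
  bound = subst (suc (suc m) ≤_) (sym (2^suc (suc r)))
            (subst (λ t → suc (suc m) ≤ t + t) m+1≡2^suc (s≤s (m≤n+m (suc m) m)))

lemma2p2 : (n : ℕ) → 1 ≤ n →
    Σ (Subgraph n) λ H → MaxDegreeAtMost H 10 ×
    (∀ u v → Antipodal u v → DistEq H u v n)
lemma2p2 n 1≤n with dyadic-bracket n 1≤n
... | r , lower , upper =
  H , (λ w → ≤-trans (degree-bound 2 fibre≤2 w) (m≤m+n 4 6)) , antipodal-distance (antipodal-walk lab-onto)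
  where open BinaryLabelling n r lower upper
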